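{- Let $\circ$ be either $+$ or $\times$ (the same symbol throughout), and let $U,V,W,X,Y$ be variables. The set of asymmetric equations $\{V\circ W =^{\downarrow} U,\ X\circ Y =^{\downarrow} U\}$ has exactly the same asymmetric $R,\emptyset$-unifiers as the set $\{V\circ W =^{\downarrow} U,\ X =^{\downarrow} V,\ Y =^{\downarrow} W\}$.
   Context: Signature: binary symbols $+,\times$; terms are built from these and variables. $R=\{X\times(Y+Z)\to X\times Y+X\times Z\}$, $E=\emptyset$, and $\Delta$ is the equational theory generated by $X\times(Y+Z)=X\times Y+X\times Z$. $R$ is confluent and terminating; $t\downarrow$ denotes the $R$-normal form of $t$. A substitution $\delta$ is an asymmetric $R,\emptyset$-unifier of a set $\{s_1=^{\downarrow}t_1,\dots,s_n=^{\downarrow}t_n\}$ iff for each $i$, $\delta(s_i)=_\Delta\delta(t_i)$ and $(t_i\downarrow)\delta$ is in $R$-normal form. Standing convention: all substitutions are $R$-normalized, i.e., map every variable to an $R$-normal form. -}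

module Defs where

open import Data.Nat using (ℕ)
open import Data.Product using (∃; _×_)
open import Data.List using (List; _∷_; [])
open import Data.List.Relation.Unary.All using (All)
open import Relation.Nullary using (¬_)
open import Relation.Binary.Construct.Closure.ReflexiveTransitive using (Star)
open import Relation.Binary.Construct.Closure.Equivalence using (EqClosure)

Var : Set
Var = ℕ

infixl 6 _⊕_
infixl 7 _⊗_
data Term : Set where
  var : Var → Term
  _⊕_ : Term → Term → Term
  _⊗_ : Term → Term → Term

data _⟶_ : Term → Term → Set where
  root  : ∀ x y z → (x ⊗ (y ⊕ z)) ⟶ ((x ⊗ y) ⊕ (x ⊗ z))
  ⊕-l   : ∀ {s s'} t → s ⟶ s' → (s ⊕ t) ⟶ (s' ⊕ t)
  ⊕-r   : ∀ {t t'} s → t ⟶ t' → (s ⊕ t) ⟶ (s ⊕ t')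
  ⊗-l   : ∀ {s s'} t → s ⟶ s' → (s ⊗ t) ⟶ (s' ⊗ t)
  ⊗-r   : ∀ {t t'} s → t ⟶ t' → (s ⊗ t) ⟶ (s ⊗ t')

_⟶*_ : Term → Term → Set
_⟶*_ = Star _⟶_

Normal : Term → Set
Normal t = ∀ {t'} → ¬ (t ⟶ t')

IsNF : Term → Term → Set
IsNF t n = (t ⟶* n) × Normal n

_≈Δ_ : Term → Term → Set
_≈Δ_ = EqClosure _⟶_

Subst : Set
Subst = Var → Term

_[_] : Term → Subst → Term
var x [ σ ] = σ x
(s ⊕ t) [ σ ] = (s [ σ ]) ⊕ (t [ σ ])
(s ⊗ t) [ σ ] = (s [ σ ]) ⊗ (t [ σ ])

-- R-normalized substitution (standing convention).
Normalized : Subst → Set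
Normalized σ = ∀ x → Normal (σ x)

infix 4 _=↓_
record AsymEq : Set where
  constructor _=↓_
  field
    lhs : Term
    rhs : Term

SolvesAsym : Subst → AsymEq → Set
SolvesAsym δ (s =↓ t) =
  ((s [ δ ]) ≈Δ (t [ δ ])) × (∀ n → IsNF t n → Normal (n [ δ ]))

AsymUnifier : List AsymEq → Subst → Set
AsymUnifier eqs δ = All (SolvesAsym δ) eqs

data Op : Set where
  plus times : Op

app : Op → Term → Term → Term
app plus  = _⊕_
app times = _⊗_

-- R has a normalisation function computable by structural recursion: distribute each
-- product over the sums of its (already normalised) right factor. It is constant on
-- Δ-classes and fixes R-normal terms, so Δ-equal normal terms are equal and, after
-- normalisation, V ∘ W is injective. For an R-normalised δ this turns
-- δX ∘ δY =Δ δU =Δ δV ∘ δW into δX = δV and δY = δW. The normality side conditions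
-- are automatic because every right-hand side is a variable, whose only normal form
-- is itself.
module Submission where

open import Defs
open import Data.Empty using (⊥-elim)
open import Data.List using (_∷_; [])
open import Data.List.Relation.Unary.All using (_∷_; [])
open import Data.Product using (_×_; _,_)
open import Function.Bundles using (_⇔_; mk⇔)
open import Relation.Binary.PropositionalEquality
  using (_≡_; refl; sym; cong; cong₂; subst; isEquivalence)
open import Relation.Binary.Construct.Closure.ReflexiveTransitive using (ε; _◅_)
import Relation.Binary.Construct.Closure.Equivalence as EqClosure

≈Δ-sym : ∀ {s t} → s ≈Δ t → t ≈Δ s
≈Δ-sym = EqClosure.symmetric _⟶_

≈Δ-trans : ∀ {s t u} → s ≈Δ t → t ≈Δ u → s ≈Δ u
≈Δ-trans = EqClosure.transitive _⟶_

≡⇒≈Δ : ∀ {s t} → s ≡ t → s ≈Δ t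
≡⇒≈Δ refl = ε

app-cong : ∀ ∘ {s s' t t'} → s ≈Δ s' → t ≈Δ t' → app ∘ s t ≈Δ app ∘ s' t'
app-cong plus  {s' = s'} {t = t} p q =
  ≈Δ-trans (EqClosure.gmap (_⊕ t) (⊕-l t) p) (EqClosure.gmap (s' ⊕_) (⊕-r s') q)
app-cong times {s' = s'} {t = t} p q =
  ≈Δ-trans (EqClosure.gmap (_⊗ t) (⊗-l t) p) (EqClosure.gmap (s' ⊗_) (⊗-r s') q)

app-[] : ∀ ∘ s t (σ : Subst) → (app ∘ s t [ σ ]) ≡ app ∘ (s [ σ ]) (t [ σ ])
app-[] plus  s t σ = refl
app-[] times s t σ = refl

⊕-injective : ∀ {a b c d} → a ⊕ b ≡ c ⊕ d → a ≡ c × b ≡ d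
⊕-injective refl = refl , refl

infixl 7 _⊗↓_
_⊗↓_ : Term → Term → Term
a ⊗↓ (b ⊕ c) = a ⊗↓ b ⊕ a ⊗↓ c
a ⊗↓ var x   = a ⊗ var x
a ⊗↓ (b ⊗ c) = a ⊗ (b ⊗ c)

⊗↓-injective : ∀ a b c d → a ⊗↓ b ≡ c ⊗↓ d → a ≡ c × b ≡ d
⊗↓-injective a (b₁ ⊕ b₂) c (d₁ ⊕ d₂) e with ⊕-injective e
... | e₁ , e₂ with ⊗↓-injective a b₁ c d₁ e₁ | ⊗↓-injective a b₂ c d₂ e₂
...   | refl , refl | _ , refl = refl , refl
⊗↓-injective a (var x)   c (var y)   refl = refl , refl
⊗↓-injective a (b₁ ⊗ b₂) c (d₁ ⊗ d₂) refl = refl , refl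
⊗↓-injective a (_ ⊕ _) c (var _) ()
⊗↓-injective a (_ ⊕ _) c (_ ⊗ _) ()
⊗↓-injective a (var _) c (_ ⊕ _) ()
⊗↓-injective a (var _) c (_ ⊗ _) ()
⊗↓-injective a (_ ⊗ _) c (_ ⊕ _) ()
⊗↓-injective a (_ ⊗ _) c (var _) ()

nf : Term → Term
nf (var x) = var x
nf (s ⊕ t) = nf s ⊕ nf t
nf (s ⊗ t) = nf s ⊗↓ nf t

nf-resp-⟶ : ∀ {s t} → s ⟶ t → nf s ≡ nf t
nf-resp-⟶ (root x y z) = refl
nf-resp-⟶ (⊕-l t p)    = cong (_⊕ nf t) (nf-resp-⟶ p)
nf-resp-⟶ (⊕-r s p)    = cong (nf s ⊕_) (nf-resp-⟶ p)
nf-resp-⟶ (⊗-l t p)    = cong (_⊗↓ nf t) (nf-resp-⟶ p)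
nf-resp-⟶ (⊗-r s p)    = cong (nf s ⊗↓_) (nf-resp-⟶ p)

nf-resp-≈Δ : ∀ {s t} → s ≈Δ t → nf s ≡ nf t
nf-resp-≈Δ = EqClosure.gfold isEquivalence nf nf-resp-⟶

nf-normal : ∀ t → Normal t → nf t ≡ t
nf-normal (var x)       N = refl
nf-normal (a ⊕ b)       N =
  cong₂ _⊕_ (nf-normal a (λ p → N (⊕-l b p))) (nf-normal b (λ p → N (⊕-r a p)))
nf-normal (a ⊗ var x)   N = cong (_⊗ var x) (nf-normal a (λ p → N (⊗-l (var x) p)))
nf-normal (a ⊗ (b ⊕ c)) N = ⊥-elim (N (root a b c))
nf-normal (a ⊗ (b ⊗ c)) N =
  cong₂ _⊗↓_ (nf-normal a (λ p → N (⊗-l (b ⊗ c) p))) (nf-normal (b ⊗ c) (λ p → N (⊗-r a p)))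

app↓ : Op → Term → Term → Term
app↓ plus  = _⊕_
app↓ times = _⊗↓_

nf-app : ∀ ∘ s t → nf (app ∘ s t) ≡ app↓ ∘ (nf s) (nf t)
nf-app plus  s t = refl
nf-app times s t = refl

app↓-injective : ∀ ∘ a b c d → app↓ ∘ a b ≡ app↓ ∘ c d → a ≡ c × b ≡ d
app↓-injective plus  a b c d = ⊕-injective
app↓-injective times a b c d = ⊗↓-injective a b c d

app-injective-≈Δ : ∀ ∘ {a b c d} → Normal a → Normal b → Normal c → Normal d →
                   app ∘ a b ≈Δ app ∘ c d → a ≡ c × b ≡ d
app-injective-≈Δ ∘ {a} {b} {c} {d} Na Nb Nc Nd e =
  app↓-injective ∘ a b c d (begin
    app↓ ∘ a b              ≡⟨ sym (cong₂ (app↓ ∘) (nf-normal a Na) (nf-normal b Nb)) ⟩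
    app↓ ∘ (nf a) (nf b)    ≡⟨ sym (nf-app ∘ a b) ⟩
    nf (app ∘ a b)          ≡⟨ nf-resp-≈Δ e ⟩
    nf (app ∘ c d)          ≡⟨ nf-app ∘ c d ⟩
    app↓ ∘ (nf c) (nf d)    ≡⟨ cong₂ (app↓ ∘) (nf-normal c Nc) (nf-normal d Nd) ⟩
    app↓ ∘ c d              ∎)
  where open Relation.Binary.PropositionalEquality.≡-Reasoning

var-nf : ∀ {x n} → IsNF (var x) n → n ≡ var x
var-nf (ε , _)       = refl
var-nf ((() ◅ _) , _)

solves-var-rhs : ∀ {δ} → Normalized δ → ∀ s {x} → (s [ δ ]) ≈Δ δ x → SolvesAsym δ (s =↓ var x)
solves-var-rhs {δ} N s {x} e = e , λ n n↓ → subst (λ m → Normal (m [ δ ])) (sym (var-nf n↓)) (N x)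

lemma7p5 : (∘ : Op) (U V W X Y : Var) (δ : Subst) → Normalized δ →
    AsymUnifier ((app ∘ (var V) (var W) =↓ var U) ∷ (app ∘ (var X) (var Y) =↓ var U) ∷ []) δ
    ⇔ AsymUnifier ((app ∘ (var V) (var W) =↓ var U) ∷ (var X =↓ var V) ∷ (var Y =↓ var W) ∷ []) δ
lemma7p5 ∘ U V W X Y δ N = mk⇔ to from
  where
  [δ]-app : ∀ A B → (app ∘ (var A) (var B) [ δ ]) ≡ app ∘ (δ A) (δ B)
  [δ]-app A B = app-[] ∘ (var A) (var B) δ

  to : AsymUnifier ((app ∘ (var V) (var W) =↓ var U) ∷ (app ∘ (var X) (var Y) =↓ var U) ∷ []) δ →
       AsymUnifier ((app ∘ (var V) (var W) =↓ var U) ∷ (var X =↓ var V) ∷ (var Y =↓ var W) ∷ []) δ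
  to (VW=U@(eVW , _) ∷ (eXY , _) ∷ []) with
    app-injective-≈Δ ∘ (N X) (N Y) (N V) (N W)
      (≈Δ-trans (subst (_≈Δ δ U) ([δ]-app X Y) eXY) (≈Δ-sym (subst (_≈Δ δ U) ([δ]-app V W) eVW)))
  ... | X=V , Y=W = VW=U ∷ solves-var-rhs N (var X) (≡⇒≈Δ X=V) ∷ solves-var-rhs N (var Y) (≡⇒≈Δ Y=W) ∷ []

  from : AsymUnifier ((app ∘ (var V) (var W) =↓ var U) ∷ (var X =↓ var V) ∷ (var Y =↓ var W) ∷ []) δ →
         AsymUnifier ((app ∘ (var V) (var W) =↓ var U) ∷ (app ∘ (var X) (var Y) =↓ var U) ∷ []) δ
  from (VW=U@(eVW , _) ∷ (eXV , _) ∷ (eYW , _) ∷ []) =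
    VW=U ∷ solves-var-rhs N (app ∘ (var X) (var Y))
             (subst (_≈Δ δ U) (sym ([δ]-app X Y))
               (≈Δ-trans (app-cong ∘ eXV eYW) (subst (_≈Δ δ U) ([δ]-app V W) eVW))) ∷ []
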